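{- Let $n$ be an odd positive integer with $s(3n)=4$. Then either $n\le 2^{2s(n)-1}$, or the binary expansion of $n$ has the form $x_1\,0^{t}\,x_0$ for some $t\ge2$ (a block of $t$ zero bits), where each of the binary words $x_1,x_0$ is either $1$ or $(10)^\ell 11$ for some $\ell\ge0$.
   Context: $s(n)$ is the sum of binary digits of $n$; binary words are written from most significant to least significant bit; $(10)^\ell 11$ denotes $\ell$ copies of the block $10$ followed by $11$. -}

module Defs where

open import Data.Bool using (Bool; true; false)
open import Data.Nat using (ℕ; zero; suc; _+_; _*_; _/_; _%_)
open import Data.List using (List; []; _∷_; _++_; replicate; foldl; concat)
open import Data.Product using (∃; _×_)
open import Data.Sum using (_⊎_)
open import Relation.Binary.PropositionalEquality using (_≡_)

-- value of a binary word written most significant bit first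
bit : Bool → ℕ
bit true  = 1
bit false = 0

value : List Bool → ℕ
value = foldl (λ acc b → 2 * acc + bit b) 0

-- sum of binary digits, computed with fuel (fuel n suffices for n)
sbits-fuel : ℕ → ℕ → ℕ
sbits-fuel zero    n = 0
sbits-fuel (suc f) n = n % 2 + sbits-fuel f (n / 2)

s : ℕ → ℕ
s n = sbits-fuel n n

blockWord : ℕ → List Bool
blockWord ℓ = concat (replicate ℓ (true ∷ false ∷ [])) ++ (true ∷ true ∷ [])

IsSpecialWord : List Bool → Set
IsSpecialWord x = (x ≡ true ∷ []) ⊎ ∃ λ ℓ → x ≡ blockWord ℓ

-- Since n is odd and s(3n) = 4, 3n = 1 + 2^a + 2^b + 2^c with 0 < a < b < c, and since
-- 2^e ≡ (-1)^e (mod 3), exactly two of a, b, c are odd.  Let B m = (01)^m 1, the binary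
-- word of (2^(2m+1) + 1)/3; up to a leading zero it is 1 or (10)^(m-1) 11.
-- If a = 2p + 1 and c - b = 2r + 1, then n = 2^b (2^(c-b) + 1)/3 + (2^a + 1)/3 has the binary
-- word B r 0^(b-a) B p, which is of the special form unless a = 1 and b = 2.  If a is even, n has
-- the binary word (01)^x 1 (01)^y 1 (01)^z 1.  In the two remaining cases the word has fewer
-- than 2 s(n) digits, so n < 2^(2 s(n) - 1).
module Submission where

open import Defs
open import Data.Bool using (Bool; true; false)
open import Data.Empty using (⊥-elim)
open import Data.List using (List; []; _∷_; _++_; replicate; foldl; length; map)
open import Data.List.Properties using (foldl-++; length-++; length-replicate; map-++)
open import Data.Nat
open import Data.Nat.DivMod
open import Data.Nat.ListAction using (sum)
open import Data.Nat.ListAction.Properties using (sum-++)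
open import Data.Nat.Divisibility using (_∣_; m∣m*n; n∣m*n; n∣m⇒m%n≡0)
open import Data.Nat.Induction using (<-rec)
open import Data.Nat.Properties
open import Data.Nat.Tactic.RingSolver using (solve-∀)
open import Data.Product using (Σ; ∃-syntax; _×_; _,_)
open import Data.Sum using (_⊎_; inj₁; inj₂)
open import Relation.Binary.PropositionalEquality
open import Relation.Nullary using (contradiction)

sbits-fuel-0 : ∀ f → sbits-fuel f 0 ≡ 0
sbits-fuel-0 zero    = refl
sbits-fuel-0 (suc f) = sbits-fuel-0 f

sbits-fuel-irrelevant : ∀ {f g x} → x ≤ f → x ≤ g → sbits-fuel f x ≡ sbits-fuel g x
sbits-fuel-irrelevant {f} {g} {zero} _ _ = trans (sbits-fuel-0 f) (sym (sbits-fuel-0 g))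
sbits-fuel-irrelevant {suc f} {suc g} {suc x} (s≤s x≤f) (s≤s x≤g) =
  cong (suc x % 2 +_) (sbits-fuel-irrelevant (≤-trans half≤x x≤f) (≤-trans half≤x x≤g))
  where
  half≤x : suc x / 2 ≤ x
  half≤x = ≤-pred (m/n<m (suc x) 2 (s≤s (s≤s z≤n)))

sbits-fuel≡s : ∀ {f x} → x ≤ f → sbits-fuel f x ≡ s x
sbits-fuel≡s x≤f = sbits-fuel-irrelevant x≤f ≤-refl

push : ℕ → Bool → ℕ
push acc b = 2 * acc + bit b

bit<2 : ∀ b → bit b < 2
bit<2 false = s≤s z≤n
bit<2 true  = s≤s (s≤s z≤n)

push≡ : ∀ x b → push x b ≡ bit b + x * 2
push≡ x b = trans (+-comm (2 * x) (bit b)) (cong (bit b +_) (*-comm 2 x))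

push%2 : ∀ x b → push x b % 2 ≡ bit b
push%2 x b = begin
  push x b % 2          ≡⟨ cong (_% 2) (push≡ x b) ⟩
  (bit b + x * 2) % 2   ≡⟨ [m+kn]%n≡m%n (bit b) x 2 ⟩
  bit b % 2             ≡⟨ m<n⇒m%n≡m (bit<2 b) ⟩
  bit b                 ∎
  where open ≡-Reasoning

push/2 : ∀ x b → push x b / 2 ≡ x
push/2 x b = begin
  push x b / 2              ≡⟨ cong (_/ 2) (push≡ x b) ⟩
  (bit b + x * 2) / 2       ≡⟨ +-distrib-/-∣ʳ (bit b) (n∣m*n x) ⟩
  bit b / 2 + x * 2 / 2     ≡⟨ cong₂ _+_ (m<n⇒m/n≡0 (bit<2 b)) (m*n/n≡m x 2) ⟩
  x                         ∎
  where open ≡-Reasoning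

s-push : ∀ x b → s (push x b) ≡ bit b + s x
s-push x b = begin
  s (push x b)                              ≡⟨ sbits-fuel≡s (n≤1+n (push x b)) ⟨
  sbits-fuel (suc (push x b)) (push x b)    ≡⟨ cong₂ _+_ (push%2 x b) (cong (sbits-fuel (push x b)) (push/2 x b)) ⟩
  bit b + sbits-fuel (push x b) x           ≡⟨ cong (bit b +_) (sbits-fuel≡s x≤push) ⟩
  bit b + s x                               ∎
  where
  open ≡-Reasoning
  x≤push : x ≤ push x b
  x≤push = ≤-trans (m≤m+n x (x + 0)) (m≤m+n (2 * x) (bit b))

s-double : ∀ x → s (2 * x) ≡ s x
s-double x = trans (cong s (sym (+-identityʳ (2 * x)))) (s-push x false)

s-odd : ∀ x → s (1 + 2 * x) ≡ suc (s x)
s-odd x = trans (cong s (+-comm 1 (2 * x))) (s-push x true)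

s-2^* : ∀ j y → s (2 ^ j * y) ≡ s y
s-2^* zero    y = cong s (+-identityʳ y)
s-2^* (suc j) y = trans (cong s (*-assoc 2 (2 ^ j) y)) (trans (s-double (2 ^ j * y)) (s-2^* j y))

data EvenOdd : ℕ → Set where
  even : ∀ k → EvenOdd (2 * k)
  odd  : ∀ k → EvenOdd (1 + 2 * k)

evenOdd : ∀ m → EvenOdd m
evenOdd zero = even 0
evenOdd (suc m) with evenOdd m
... | even k = odd k
... | odd  k = subst EvenOdd (*-suc 2 k) (even (suc k))

2*k%2≡0 : ∀ k → 2 * k % 2 ≡ 0
2*k%2≡0 k = trans (cong (_% 2) (*-comm 2 k)) (m*n%n≡0 k 2)

odd-part : ∀ m → 0 < m → ∃[ j ] ∃[ r ] m ≡ 2 ^ j * (1 + 2 * r)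
odd-part = <-rec _ odd-part′
  where
  odd-part′ : ∀ m → (∀ {k} → k < m → 0 < k → ∃[ j ] ∃[ r ] k ≡ 2 ^ j * (1 + 2 * r)) →
              0 < m → ∃[ j ] ∃[ r ] m ≡ 2 ^ j * (1 + 2 * r)
  odd-part′ m rec 0<m with evenOdd m
  odd-part′ _ _   _   | odd r          = 0 , r , sym (+-identityʳ _)
  odd-part′ _ _   ()  | even zero
  odd-part′ _ rec _   | even (suc k) with rec (m<m+n (suc k) (s≤s z≤n)) (s≤s z≤n)
  ... | j , r , k≡ = suc j , r , trans (cong (2 *_) k≡) (sym (*-assoc 2 (2 ^ j) _))

s-odd-part : ∀ j r → s (2 ^ j * (1 + 2 * r)) ≡ suc (s r)
s-odd-part j r = trans (s-2^* j (1 + 2 * r)) (s-odd r)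

split-lowest-one : ∀ {m k} → s m ≡ suc k → ∃[ j ] ∃[ r ] m ≡ 2 ^ j * (1 + 2 * r) × s r ≡ k
split-lowest-one {suc m} s≡ with odd-part (suc m) (s≤s z≤n)
... | j , r , m≡ = j , r , m≡ , suc-injective (trans (sym (s-odd-part j r)) (trans (cong s (sym m≡)) s≡))

s≡0⇒≡0 : ∀ {m} → s m ≡ 0 → m ≡ 0
s≡0⇒≡0 {zero}  _  = refl
s≡0⇒≡0 {suc m} s≡ with odd-part (suc m) (s≤s z≤n)
... | j , r , m≡ = ⊥-elim (1+n≢0 (trans (sym (s-odd-part j r)) (trans (cong s (sym m≡)) s≡)))

-- binary 1 0^k 1 0^j 1 0^i 1
fourBits : ℕ → ℕ → ℕ → ℕ
fourBits i j k = 1 + 2 * (2 ^ i * (1 + 2 * (2 ^ j * (1 + 2 * 2 ^ k))))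

odd-with-four-ones : ∀ {m} → m % 2 ≡ 1 → s m ≡ 4 → ∃[ i ] ∃[ j ] ∃[ k ] m ≡ fourBits i j k
odd-with-four-ones {m} m-odd s≡4 with evenOdd m
... | even m₁ = ⊥-elim (0≢1+n (trans (sym (2*k%2≡0 m₁)) m-odd))
... | odd m₁ with split-lowest-one {m₁} (suc-injective (trans (sym (s-odd m₁)) s≡4))
... | i , m₂ , refl , s₂ with split-lowest-one {m₂} s₂
... | j , m₃ , refl , s₃ with split-lowest-one {m₃} s₃
... | k , m₄ , refl , s₄ with s≡0⇒≡0 {m₄} s₄
... | refl = i , j , k , cong (λ x → 1 + 2 * (2 ^ i * (1 + 2 * (2 ^ j * (1 + 2 * x))))) (*-identityʳ (2 ^ k))

-- congruence modulo 3, oriented so that no subtraction is needed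
infix 4 _≡_[mod3]
_≡_[mod3] : ℕ → ℕ → Set
x ≡ a [mod3] = ∃[ q ] x ≡ a + q * 3

[mod3]-* : ∀ {x y a b} → x ≡ a [mod3] → y ≡ b [mod3] → x * y ≡ a * b [mod3]
[mod3]-* {a = a} {b = b} (q , refl) (q′ , refl) = a * q′ + q * (b + q′ * 3) , identity a b q q′
  where
  identity : ∀ a b q q′ → (a + q * 3) * (b + q′ * 3) ≡ a * b + (a * q′ + q * (b + q′ * 3)) * 3
  identity = solve-∀

[mod3]-1+2* : ∀ {x a} → x ≡ a [mod3] → 1 + 2 * x ≡ 1 + 2 * a [mod3]
[mod3]-1+2* {a = a} (q , refl) = 2 * q , identity a q
  where
  identity : ∀ a q → 1 + 2 * (a + q * 3) ≡ 1 + 2 * a + 2 * q * 3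
  identity = solve-∀

[mod3]-%3 : ∀ {x a} → x ≡ a [mod3] → 3 ∣ x → a % 3 ≡ 0
[mod3]-%3 {a = a} (q , refl) 3∣x = trans (sym ([m+kn]%n≡m%n a q 3)) (n∣m⇒m%n≡0 _ 3 3∣x)

4^q≡1 : ∀ q → 2 ^ (2 * q) ≡ 1 [mod3]
4^q≡1 zero    = 0 , refl
4^q≡1 (suc q) with 4^q≡1 q
... | t , 4^q≡ = 1 + 4 * t , (begin
  2 ^ (2 * suc q)            ≡⟨ cong (2 ^_) (*-suc 2 q) ⟩
  2 * (2 * 2 ^ (2 * q))      ≡⟨ cong (λ x → 2 * (2 * x)) 4^q≡ ⟩
  2 * (2 * (1 + t * 3))      ≡⟨ identity t ⟩
  1 + (1 + 4 * t) * 3        ∎)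
  where
  open ≡-Reasoning
  identity : ∀ t → 2 * (2 * (1 + t * 3)) ≡ 1 + (1 + 4 * t) * 3
  identity = solve-∀

2*4^q≡2 : ∀ q → 2 ^ (1 + 2 * q) ≡ 2 [mod3]
2*4^q≡2 q = [mod3]-* {2} (0 , refl) (4^q≡1 q)

fourBits-residue : ∀ i j k {a b c} → 3 ∣ fourBits i j k →
                   2 ^ i ≡ a [mod3] → 2 ^ j ≡ b [mod3] → 2 ^ k ≡ c [mod3] →
                   (1 + 2 * (a * (1 + 2 * (b * (1 + 2 * c))))) % 3 ≡ 0
fourBits-residue i j k 3∣ ra rb rc =
  [mod3]-%3 ([mod3]-1+2* ([mod3]-* ra ([mod3]-1+2* ([mod3]-* rb ([mod3]-1+2* rc))))) 3∣

data DivisibleGaps : ℕ → ℕ → ℕ → Set where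
  even-even    : ∀ p j r → DivisibleGaps (2 * p) j (2 * r)
  odd-even-odd : ∀ u β γ → DivisibleGaps (1 + 2 * u) (2 * β) (1 + 2 * γ)

-- The exponents of fourBits i j k are 1 + i, 2 + i + j and 3 + i + j + k, and exactly two
-- of them are odd when 3 divides it.
fourBits-gaps : ∀ i j k → 3 ∣ fourBits i j k → DivisibleGaps i j k
fourBits-gaps i j k 3∣ with evenOdd i | evenOdd j | evenOdd k
... | even p | _      | even r = even-even p j r
... | odd u  | even β | odd γ  = odd-even-odd u β γ
... | even p | even q | odd  r =
  contradiction (fourBits-residue (2 * p) (2 * q) (1 + 2 * r) 3∣ (4^q≡1 p) (4^q≡1 q) (2*4^q≡2 r)) λ ()
... | even p | odd  q | odd  r =
  contradiction (fourBits-residue (2 * p) (1 + 2 * q) (1 + 2 * r) 3∣ (4^q≡1 p) (2*4^q≡2 q) (2*4^q≡2 r)) λ ()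
... | odd  u | even q | even r =
  contradiction (fourBits-residue (1 + 2 * u) (2 * q) (2 * r) 3∣ (2*4^q≡2 u) (4^q≡1 q) (4^q≡1 r)) λ ()
... | odd  u | odd  q | even r =
  contradiction (fourBits-residue (1 + 2 * u) (1 + 2 * q) (2 * r) 3∣ (2*4^q≡2 u) (2*4^q≡2 q) (4^q≡1 r)) λ ()
... | odd  u | odd  q | odd  r =
  contradiction (fourBits-residue (1 + 2 * u) (1 + 2 * q) (1 + 2 * r) 3∣ (2*4^q≡2 u) (2*4^q≡2 q) (2*4^q≡2 r)) λ ()

foldl-push : ∀ acc ys → foldl push acc ys ≡ acc * 2 ^ length ys + value ys
foldl-push acc []       = sym (trans (cong (_+ 0) (*-identityʳ acc)) (+-identityʳ acc))
foldl-push acc (y ∷ ys) = begin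
  foldl push (push acc y) ys                                  ≡⟨ foldl-push (push acc y) ys ⟩
  push acc y * 2 ^ length ys + value ys                       ≡⟨ horner acc (bit y) (2 ^ length ys) (value ys) ⟩
  acc * 2 ^ length (y ∷ ys) + (bit y * 2 ^ length ys + value ys) ≡⟨ cong (acc * 2 ^ length (y ∷ ys) +_) (foldl-push (bit y) ys) ⟨
  acc * 2 ^ length (y ∷ ys) + value (y ∷ ys)                  ∎
  where
  open ≡-Reasoning
  horner : ∀ a b P v → (2 * a + b) * P + v ≡ a * (2 * P) + (b * P + v)
  horner = solve-∀

value-++ : ∀ xs ys → value (xs ++ ys) ≡ value xs * 2 ^ length ys + value ys
value-++ xs ys = trans (foldl-++ push 0 xs ys) (foldl-push (value xs) ys)

value-zeros-++ : ∀ t ys → value (replicate t false ++ ys) ≡ value ys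
value-zeros-++ zero    ys = refl
value-zeros-++ (suc t) ys = value-zeros-++ t ys

bit*≤ : ∀ b n → bit b * n ≤ n
bit*≤ false n = z≤n
bit*≤ true  n = ≤-reflexive (+-identityʳ n)

value<2^length : ∀ w → value w < 2 ^ length w
value<2^length []      = s≤s z≤n
value<2^length (b ∷ w) =
  subst₂ _<_ (sym (foldl-push (bit b) w)) (cong (2 ^ length w +_) (sym (+-identityʳ (2 ^ length w))))
    (+-mono-≤-< (bit*≤ b (2 ^ length w)) (value<2^length w))

ones : List Bool → ℕ
ones w = sum (map bit w)

ones-++ : ∀ xs ys → ones (xs ++ ys) ≡ ones xs + ones ys
ones-++ xs ys = trans (cong sum (map-++ bit xs ys)) (sum-++ (map bit xs) (map bit ys))

s-foldl-push : ∀ acc ys → s (foldl push acc ys) ≡ s acc + ones ys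
s-foldl-push acc []       = sym (+-identityʳ (s acc))
s-foldl-push acc (y ∷ ys) = begin
  s (foldl push (push acc y) ys)  ≡⟨ s-foldl-push (push acc y) ys ⟩
  s (push acc y) + ones ys        ≡⟨ cong (_+ ones ys) (trans (s-push acc y) (+-comm (bit y) (s acc))) ⟩
  s acc + bit y + ones ys         ≡⟨ +-assoc (s acc) (bit y) (ones ys) ⟩
  s acc + ones (y ∷ ys)           ∎
  where open ≡-Reasoning

s-value : ∀ w → s (value w) ≡ ones w
s-value = s-foldl-push 0

value≤2^[2s∸1] : ∀ w → length w < 2 * ones w → value w ≤ 2 ^ (2 * s (value w) ∸ 1)
value≤2^[2s∸1] w length<2ones = begin
  value w                      ≤⟨ <⇒≤ (value<2^length w) ⟩
  2 ^ length w                 ≤⟨ ^-monoʳ-≤ 2 (∸-monoˡ-≤ 1 length<2ones) ⟩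
  2 ^ (2 * ones w ∸ 1)         ≡⟨ cong (λ k → 2 ^ (2 * k ∸ 1)) (s-value w) ⟨
  2 ^ (2 * s (value w) ∸ 1)    ∎
  where open ≤-Reasoning

length<2*ones-++ : ∀ xs ys → length xs < 2 * ones xs → length ys ≤ 2 * ones ys →
                   length (xs ++ ys) < 2 * ones (xs ++ ys)
length<2*ones-++ xs ys xs< ys≤ =
  subst₂ _<_ (sym (length-++ xs)) (sym (trans (cong (2 *_) (ones-++ xs ys)) (*-distribˡ-+ 2 (ones xs) (ones ys))))
    (+-mono-<-≤ xs< ys≤)

-- (01)^m 1, the binary expansion of (2^(2m+1) + 1)/3
block : ℕ → List Bool
block zero    = true ∷ []
block (suc m) = false ∷ true ∷ block m

length-block : ∀ m → length (block m) ≡ suc (2 * m)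
length-block zero    = refl
length-block (suc m) = trans (cong (2 +_) (length-block m)) (cong suc (sym (*-suc 2 m)))

ones-block : ∀ m → ones (block m) ≡ suc m
ones-block zero    = refl
ones-block (suc m) = cong suc (ones-block m)

length<2*ones-block : ∀ m → length (block m) < 2 * ones (block m)
length<2*ones-block m =
  subst₂ _<_ (sym (length-block m)) (trans (sym (*-suc 2 m)) (cong (2 *_) (sym (ones-block m))))
    (n<1+n (suc (2 * m)))

3*value-block : ∀ m → 3 * value (block m) ≡ 1 + 2 * 2 ^ (2 * m)
3*value-block zero    = refl
3*value-block (suc m) = begin
  3 * value (block (suc m))                                   ≡⟨ cong (3 *_) (foldl-push 1 (block m)) ⟩
  3 * (1 * 2 ^ length (block m) + value (block m))            ≡⟨ cong (λ L → 3 * (1 * 2 ^ L + value (block m))) (length-block m) ⟩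
  3 * (1 * 2 ^ suc (2 * m) + value (block m))                 ≡⟨ *-distribˡ-+ 3 (1 * 2 ^ suc (2 * m)) (value (block m)) ⟩
  3 * (1 * 2 ^ suc (2 * m)) + 3 * value (block m)             ≡⟨ cong (3 * (1 * 2 ^ suc (2 * m)) +_) (3*value-block m) ⟩
  3 * (1 * (2 * 2 ^ (2 * m))) + (1 + 2 * 2 ^ (2 * m))         ≡⟨ identity (2 ^ (2 * m)) ⟩
  1 + 2 * (2 * (2 * 2 ^ (2 * m)))                             ≡⟨ cong (λ e → 1 + 2 * 2 ^ e) (*-suc 2 m) ⟨
  1 + 2 * 2 ^ (2 * suc m)                                     ∎
  where
  open ≡-Reasoning
  identity : ∀ F → 3 * (1 * (2 * F)) + (1 + 2 * F) ≡ 1 + 2 * (2 * (2 * F))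
  identity = solve-∀

3*value-++ : ∀ xs ys → 3 * value (xs ++ ys) ≡ 3 * value xs * 2 ^ length ys + 3 * value ys
3*value-++ xs ys = begin
  3 * value (xs ++ ys)                                   ≡⟨ cong (3 *_) (value-++ xs ys) ⟩
  3 * (value xs * 2 ^ length ys + value ys)              ≡⟨ *-distribˡ-+ 3 (value xs * 2 ^ length ys) (value ys) ⟩
  3 * (value xs * 2 ^ length ys) + 3 * value ys          ≡⟨ cong (_+ 3 * value ys) (*-assoc 3 (value xs) (2 ^ length ys)) ⟨
  3 * value xs * 2 ^ length ys + 3 * value ys            ∎
  where open ≡-Reasoning

3*value-block-++ : ∀ m ys → 3 * value (block m ++ ys) ≡ (1 + 2 * 2 ^ (2 * m)) * 2 ^ length ys + 3 * value ys
3*value-block-++ m ys = trans (3*value-++ (block m) ys) (cong (λ x → x * 2 ^ length ys + 3 * value ys) (3*value-block m))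

2^length-block-++ : ∀ m ys → 2 ^ length (block m ++ ys) ≡ 2 * 2 ^ (2 * m) * 2 ^ length ys
2^length-block-++ m ys = begin
  2 ^ length (block m ++ ys)                 ≡⟨ cong (2 ^_) (length-++ (block m)) ⟩
  2 ^ (length (block m) + length ys)         ≡⟨ ^-distribˡ-+-* 2 (length (block m)) (length ys) ⟩
  2 ^ length (block m) * 2 ^ length ys       ≡⟨ cong (λ L → 2 ^ L * 2 ^ length ys) (length-block m) ⟩
  2 * 2 ^ (2 * m) * 2 ^ length ys            ∎
  where open ≡-Reasoning

3*value-twoBlocks : ∀ r j p →
  3 * value (block r ++ replicate (suc j) false ++ block p) ≡ fourBits (2 * p) j (2 * r)
3*value-twoBlocks r j p = begin
  3 * value (block r ++ gap)                            ≡⟨ 3*value-block-++ r gap ⟩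
  (1 + 2 * R) * 2 ^ length gap + 3 * value gap          ≡⟨ cong₂ (λ x y → (1 + 2 * R) * x + y) 2^length-gap 3*value-gap ⟩
  (1 + 2 * R) * (2 * 2 ^ j * (2 * P)) + (1 + 2 * P)     ≡⟨ identity R (2 ^ j) P ⟩
  fourBits (2 * p) j (2 * r)                            ∎
  where
  open ≡-Reasoning
  gap : List Bool
  gap = replicate (suc j) false ++ block p
  R P : ℕ
  R = 2 ^ (2 * r)
  P = 2 ^ (2 * p)
  2^length-gap : 2 ^ length gap ≡ 2 * 2 ^ j * (2 * P)
  2^length-gap = begin
    2 ^ length gap                                             ≡⟨ cong (2 ^_) (length-++ (replicate (suc j) false)) ⟩
    2 ^ (length (replicate (suc j) false) + length (block p))  ≡⟨ cong₂ (λ a b → 2 ^ (a + b)) (length-replicate (suc j)) (length-block p) ⟩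
    2 ^ (suc j + suc (2 * p))                                  ≡⟨ ^-distribˡ-+-* 2 (suc j) (suc (2 * p)) ⟩
    2 * 2 ^ j * (2 * P)                                        ∎
  3*value-gap : 3 * value gap ≡ 1 + 2 * P
  3*value-gap = trans (cong (3 *_) (value-zeros-++ (suc j) (block p))) (3*value-block p)
  identity : ∀ R J P → (1 + 2 * R) * (2 * J * (2 * P)) + (1 + 2 * P) ≡ 1 + 2 * (P * (1 + 2 * (J * (1 + 2 * R))))
  identity = solve-∀

3*value-threeBlocks : ∀ γ β u →
  3 * value (block (suc γ) ++ block β ++ block u) ≡ fourBits (1 + 2 * u) (2 * β) (1 + 2 * γ)
3*value-threeBlocks γ β u = begin
  3 * value (block (suc γ) ++ block β ++ block u)                        ≡⟨ 3*value-block-++ (suc γ) (block β ++ block u) ⟩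
  (1 + 2 * G′) * 2 ^ length (block β ++ block u)
    + 3 * value (block β ++ block u)                                      ≡⟨ cong₂ (λ x y → (1 + 2 * G′) * x + y)
                                                                               (2^length-block-++ β (block u)) (3*value-block-++ β (block u)) ⟩
  (1 + 2 * G′) * (2 * B * 2 ^ length (block u))
    + ((1 + 2 * B) * 2 ^ length (block u) + 3 * value (block u))          ≡⟨ cong₂ (λ x y → (1 + 2 * G′) * (2 * B * x) + ((1 + 2 * B) * x + y))
                                                                               (cong (2 ^_) (length-block u)) (3*value-block u) ⟩
  (1 + 2 * G′) * (2 * B * (2 * U)) + ((1 + 2 * B) * (2 * U) + (1 + 2 * U)) ≡⟨ cong (λ x → (1 + 2 * x) * (2 * B * (2 * U)) + ((1 + 2 * B) * (2 * U) + (1 + 2 * U)))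
                                                                               (cong (2 ^_) (*-suc 2 γ)) ⟩
  (1 + 2 * (2 * (2 * G))) * (2 * B * (2 * U)) + ((1 + 2 * B) * (2 * U) + (1 + 2 * U)) ≡⟨ identity G B U ⟩
  fourBits (1 + 2 * u) (2 * β) (1 + 2 * γ)                               ∎
  where
  open ≡-Reasoning
  G′ G B U : ℕ
  G′ = 2 ^ (2 * suc γ)
  G  = 2 ^ (2 * γ)
  B  = 2 ^ (2 * β)
  U  = 2 ^ (2 * u)
  identity : ∀ G B U → (1 + 2 * (2 * (2 * G))) * (2 * B * (2 * U)) + ((1 + 2 * B) * (2 * U) + (1 + 2 * U))
                       ≡ 1 + 2 * (2 * U * (1 + 2 * (B * (1 + 2 * (2 * G)))))
  identity = solve-∀

specialWord : ℕ → List Bool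
specialWord zero    = true ∷ []
specialWord (suc ℓ) = blockWord ℓ

specialWord-special : ∀ m → IsSpecialWord (specialWord m)
specialWord-special zero    = inj₁ refl
specialWord-special (suc ℓ) = inj₂ (ℓ , refl)

true∷block≡blockWord : ∀ ℓ → true ∷ block ℓ ≡ blockWord ℓ
true∷block≡blockWord zero    = refl
true∷block≡blockWord (suc ℓ) = cong (λ w → true ∷ false ∷ w) (true∷block≡blockWord ℓ)

value-block-++ : ∀ m ys → value (block m ++ ys) ≡ value (specialWord m ++ ys)
value-block-++ zero    ys = refl
value-block-++ (suc ℓ) ys = cong (λ w → value (w ++ ys)) (true∷block≡blockWord ℓ)

replicate-++-∷ : ∀ {A : Set} t (x : A) xs → replicate t x ++ x ∷ xs ≡ x ∷ replicate t x ++ xs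
replicate-++-∷ zero    x xs = refl
replicate-++-∷ (suc t) x xs = cong (x ∷_) (replicate-++-∷ t x xs)

odd⇒3*odd : ∀ n → n % 2 ≡ 1 → 3 * n % 2 ≡ 1
odd⇒3*odd n n-odd = trans (%-distribˡ-* 3 n 2) (cong (λ r → 1 * r % 2) n-odd)

cancel-3 : ∀ {m n x} → 3 * m ≡ x → 3 * n ≡ x → m ≡ n
cancel-3 {m} {n} 3m≡x 3n≡x = *-cancelˡ-≡ m n 3 (trans 3m≡x (sym 3n≡x))

Conclusion : ℕ → Set
Conclusion n = (n ≤ 2 ^ (2 * s n ∸ 1))
  ⊎ (Σ (List Bool) λ x₁ → Σ (List Bool) λ x₀ → Σ ℕ λ t →
       (2 ≤ t) × IsSpecialWord x₁ × IsSpecialWord x₀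
       × (n ≡ value (x₁ ++ replicate t false ++ x₀)))

twoBlocks-conclusion : ∀ r j p → Conclusion (value (block r ++ replicate (suc j) false ++ block p))
twoBlocks-conclusion r zero zero =
  inj₁ (value≤2^[2s∸1] (block r ++ false ∷ true ∷ [])
         (length<2*ones-++ (block r) (false ∷ true ∷ []) (length<2*ones-block r) ≤-refl))
twoBlocks-conclusion r (suc j) zero =
  inj₂ (specialWord r , true ∷ [] , 2 + j , s≤s (s≤s z≤n) , specialWord-special r , inj₁ refl
       , value-block-++ r (replicate (2 + j) false ++ true ∷ []))
twoBlocks-conclusion r j (suc ℓ) =
  inj₂ (specialWord r , blockWord ℓ , 2 + j , s≤s (s≤s z≤n) , specialWord-special r , inj₂ (ℓ , refl)
       , trans (value-block-++ r _) (cong (λ zs → value (specialWord r ++ zs)) gap≡))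
  where
  gap≡ : replicate (suc j) false ++ block (suc ℓ) ≡ replicate (2 + j) false ++ blockWord ℓ
  gap≡ = trans (replicate-++-∷ (suc j) false (true ∷ block ℓ))
               (cong (replicate (2 + j) false ++_) (true∷block≡blockWord ℓ))

threeBlocks-bounded : ∀ γ β u → let n = value (block (suc γ) ++ block β ++ block u) in n ≤ 2 ^ (2 * s n ∸ 1)
threeBlocks-bounded γ β u = value≤2^[2s∸1] (block (suc γ) ++ block β ++ block u)
  (length<2*ones-++ (block (suc γ)) (block β ++ block u) (length<2*ones-block (suc γ))
    (<⇒≤ (length<2*ones-++ (block β) (block u) (length<2*ones-block β) (<⇒≤ (length<2*ones-block u)))))

lemma4 : (n : ℕ) → 1 ≤ n → n % 2 ≡ 1 → s (3 * n) ≡ 4 →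
    (n ≤ 2 ^ (2 * s n ∸ 1))
    ⊎ (Σ (List Bool) λ x₁ → Σ (List Bool) λ x₀ → Σ ℕ λ t →
         (2 ≤ t) × IsSpecialWord x₁ × IsSpecialWord x₀
         × (n ≡ value (x₁ ++ replicate t false ++ x₀)))
lemma4 n _ n-odd s[3n]≡4 with odd-with-four-ones (odd⇒3*odd n n-odd) s[3n]≡4
... | i , j , k , 3n≡ with fourBits-gaps i j k (subst (3 ∣_) 3n≡ (m∣m*n n))
... | even-even p j r =
  subst Conclusion (cancel-3 (3*value-twoBlocks r j p) 3n≡) (twoBlocks-conclusion r j p)
... | odd-even-odd u β γ =
  inj₁ (subst (λ m → m ≤ 2 ^ (2 * s m ∸ 1)) (cancel-3 (3*value-threeBlocks γ β u) 3n≡)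
    (threeBlocks-bounded γ β u))
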